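{- Let $(W,S)$ be a Coxeter system, $w\in W$, and $I,I',J,J'\subseteq S$. If a parabolic double coset $C$ satisfies $C=W_IwW_J=W_{I'}wW_{J'}$, then also $C=W_{I\cup I'}wW_{J\cup J'}$.
   Context: $(W,S)$ is a Coxeter system with $S$ finite; $W_I$ denotes the subgroup of $W$ generated by $I\subseteq S$. -}

module Defs where

open import Data.Nat using (ℕ; zero; suc)
open import Data.Fin using (Fin)
open import Data.Fin.Subset using (Subset; _∈_)
open import Data.List using (List; []; _∷_; _++_)
open import Data.List.Relation.Unary.All using (All)
open import Data.Product using (Σ; _×_; ∃₂)
open import Relation.Binary.PropositionalEquality using (_≡_; _≢_)

-- A Coxeter matrix on the finite generating set S = Fin n.
-- m i j = 0 encodes m(s,t) = ∞ (no relation).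
record CoxeterMatrix (n : ℕ) : Set where
  field
    m     : Fin n → Fin n → ℕ
    diag  : ∀ i → m i i ≡ 1
    symm  : ∀ i j → m i j ≡ m j i
    off   : ∀ i j → i ≢ j → m i j ≢ 1

Word : ℕ → Set
Word n = List (Fin n)

powW : ∀ {n} → Word n → ℕ → Word n
powW w zero    = []
powW w (suc k) = w ++ powW w k

module Coxeter {n : ℕ} (M : CoxeterMatrix n) where
  open CoxeterMatrix M

  -- the defining relator (s t)^{m(s,t)}  (for s = t this is s s)
  relator : Fin n → Fin n → Word n
  relator i j = powW (i ∷ j ∷ []) (m i j)

  -- Equality in the Coxeter group W = ⟨ S | (st)^{m(s,t)} ⟩:
  -- the congruence on words generated by deleting relators.
  data _≈_ : Word n → Word n → Set where
    rel    : ∀ a b i j → (a ++ relator i j ++ b) ≈ (a ++ b)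
    ≈refl  : ∀ {u} → u ≈ u
    ≈sym   : ∀ {u v} → u ≈ v → v ≈ u
    ≈trans : ∀ {u v x} → u ≈ v → v ≈ x → u ≈ x

  -- a word lies in the standard parabolic subgroup W_I if it is a product of generators from I
  -- (membership of an element of W in W_I: some representative word uses only letters of I)
  InParabolic : Subset n → Word n → Set
  InParabolic I u = All (λ s → s ∈ I) u

  -- the parabolic double coset W_I w W_J, as a predicate on (representatives of) elements of W
  DoubleCoset : Subset n → Word n → Subset n → Word n → Set
  DoubleCoset I w J x = ∃₂ λ a b → InParabolic I a × InParabolic J b × (x ≈ (a ++ w ++ b))

  -- equality of subsets of W (both predicates are invariant under ≈)
  _≐_ : (Word n → Set) → (Word n → Set) → Set
  P ≐ Q = ∀ x → (P x → Q x) × (Q x → P x)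

module Submission where

open import Defs
open import Data.Nat using (ℕ)
open import Data.Fin.Subset using (Subset; _∪_; _∈_) renaming (_⊆_ to _⊆ₛ_)
open import Data.Fin.Subset.Properties using (p⊆p∪q; x∈p∪q⁻)
open import Data.List using ([]; _∷_; _++_; [_])
open import Data.List.Properties using (++-assoc; ++-identityʳ)
open import Data.List.Relation.Unary.All as All using ([]; _∷_)
open import Data.List.Relation.Unary.All.Properties using (++⁺)
open import Data.Product using (_,_; proj₁; proj₂)
open import Data.Sum using (inj₁; inj₂)
open import Relation.Binary.Definitions using (_Respects_)
open import Relation.Binary.PropositionalEquality using (_≡_; refl; sym)
open import Relation.Unary using (_⊆_)

-- W_I w W_J is the smallest ≈-closed set of words containing w and closed under
-- left multiplication by the generators in I and right multiplication by those in J.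
-- If C = W_I w W_J = W_I' w W_J', then C is closed under left multiplication by
-- I ∪ I' and right multiplication by J ∪ J', so it contains W_{I ∪ I'} w W_{J ∪ J'}.

module CoxeterProperties {n : ℕ} (M : CoxeterMatrix n) where
  open Coxeter M

  ≡⇒≈ : ∀ {u v} → u ≡ v → u ≈ v
  ≡⇒≈ refl = ≈refl

  ∷-cong : ∀ s {u v} → u ≈ v → (s ∷ u) ≈ (s ∷ v)
  ∷-cong s (rel a b i j)  = rel (s ∷ a) b i j
  ∷-cong s ≈refl          = ≈refl
  ∷-cong s (≈sym p)       = ≈sym (∷-cong s p)
  ∷-cong s (≈trans p q)   = ≈trans (∷-cong s p) (∷-cong s q)

  ++-congʳ : ∀ q {u v} → u ≈ v → (u ++ q) ≈ (v ++ q)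
  ++-congʳ q (rel a b i j) =
    ≈trans (≡⇒≈ reassoc) (≈trans (rel a (b ++ q) i j) (≡⇒≈ (sym (++-assoc a b q))))
    where
    reassoc : ((a ++ relator i j ++ b) ++ q) ≡ (a ++ relator i j ++ b ++ q)
    reassoc rewrite ++-assoc a (relator i j ++ b) q | ++-assoc (relator i j) b q = refl
  ++-congʳ q ≈refl         = ≈refl
  ++-congʳ q (≈sym p)      = ≈sym (++-congʳ q p)
  ++-congʳ q (≈trans p r)  = ≈trans (++-congʳ q p) (++-congʳ q r)

  LeftClosed : Subset n → (Word n → Set) → Set
  LeftClosed I P = ∀ {s x} → s ∈ I → P x → P (s ∷ x)

  RightClosed : Subset n → (Word n → Set) → Set
  RightClosed J P = ∀ {t x} → t ∈ J → P x → P (x ++ [ t ])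

  module _ (P : Word n → Set) where

    leftClosed-∪ : ∀ {I I'} → LeftClosed I P → LeftClosed I' P → LeftClosed (I ∪ I') P
    leftClosed-∪ {I} {I'} closed closed' s∈I∪I' with x∈p∪q⁻ I I' s∈I∪I'
    ... | inj₁ s∈I  = closed s∈I
    ... | inj₂ s∈I' = closed' s∈I'

    rightClosed-∪ : ∀ {J J'} → RightClosed J P → RightClosed J' P → RightClosed (J ∪ J') P
    rightClosed-∪ {J} {J'} closed closed' t∈J∪J' with x∈p∪q⁻ J J' t∈J∪J'
    ... | inj₁ t∈J  = closed t∈J
    ... | inj₂ t∈J' = closed' t∈J'

    leftClosed-≐ : ∀ {I Q} → P ≐ Q → LeftClosed I Q → LeftClosed I P
    leftClosed-≐ P≐Q closed {s} {x} s∈I Px =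
      proj₂ (P≐Q (s ∷ x)) (closed {x = x} s∈I (proj₁ (P≐Q x) Px))

    rightClosed-≐ : ∀ {J Q} → P ≐ Q → RightClosed J Q → RightClosed J P
    rightClosed-≐ P≐Q closed {t} {x} t∈J Px =
      proj₂ (P≐Q (x ++ [ t ])) (closed {x = x} t∈J (proj₁ (P≐Q x) Px))

    leftClosed-parabolic : ∀ {I} → LeftClosed I P → ∀ {a y} → InParabolic I a → P y → P (a ++ y)
    leftClosed-parabolic closed []                           Py = Py
    leftClosed-parabolic closed {s ∷ a} {y} (s∈I ∷ a∈WI) Py =
      closed {x = a ++ y} s∈I (leftClosed-parabolic closed {y = y} a∈WI Py)

    rightClosed-parabolic : ∀ {J} → P Respects _≈_ → RightClosed J P →
                            ∀ {b y} → InParabolic J b → P y → P (y ++ b)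
    rightClosed-parabolic resp closed {[]} {y} [] Py = resp (≡⇒≈ (sym (++-identityʳ y))) Py
    rightClosed-parabolic resp closed {t ∷ b} {y} (t∈J ∷ b∈WJ) Py =
      resp (≡⇒≈ (++-assoc y [ t ] b))
           (rightClosed-parabolic resp closed {y = y ++ [ t ]} b∈WJ (closed {x = y} t∈J Py))

    doubleCoset-minimal : ∀ {I w J} → P Respects _≈_ → LeftClosed I P → RightClosed J P →
                          P w → DoubleCoset I w J ⊆ P
    doubleCoset-minimal {w = w} resp left right Pw (a , b , a∈WI , b∈WJ , x≈awb) =
      resp (≈sym x≈awb)
           (leftClosed-parabolic left {y = w ++ b} a∈WI (rightClosed-parabolic resp right {y = w} b∈WJ Pw))

  doubleCoset-respects : ∀ {I w J} → DoubleCoset I w J Respects _≈_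
  doubleCoset-respects x≈y (a , b , a∈WI , b∈WJ , x≈awb) =
    a , b , a∈WI , b∈WJ , ≈trans (≈sym x≈y) x≈awb

  doubleCoset-self : ∀ {I w J} → DoubleCoset I w J w
  doubleCoset-self {w = w} = [] , [] , [] , [] , ≡⇒≈ (sym (++-identityʳ w))

  doubleCoset-leftClosed : ∀ {I w J} → LeftClosed I (DoubleCoset I w J)
  doubleCoset-leftClosed {s = s} s∈I (a , b , a∈WI , b∈WJ , x≈awb) =
    s ∷ a , b , s∈I ∷ a∈WI , b∈WJ , ∷-cong s x≈awb

  doubleCoset-rightClosed : ∀ {I w J} → RightClosed J (DoubleCoset I w J)
  doubleCoset-rightClosed {w = w} {t = t} t∈J (a , b , a∈WI , b∈WJ , x≈awb) =
    a , b ++ [ t ] , a∈WI , ++⁺ b∈WJ (t∈J ∷ []) ,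
    ≈trans (++-congʳ [ t ] x≈awb) (≡⇒≈ reassoc)
    where
    reassoc : ((a ++ w ++ b) ++ [ t ]) ≡ (a ++ w ++ b ++ [ t ])
    reassoc rewrite ++-assoc a (w ++ b) [ t ] | ++-assoc w b [ t ] = refl

  doubleCoset-mono : ∀ {I I' J J' w} → I ⊆ₛ I' → J ⊆ₛ J' → DoubleCoset I w J ⊆ DoubleCoset I' w J'
  doubleCoset-mono I⊆I' J⊆J' (a , b , a∈WI , b∈WJ , x≈awb) =
    a , b , All.map I⊆I' a∈WI , All.map J⊆J' b∈WJ , x≈awb

lemma4p1 : ∀ (n : ℕ) (M : CoxeterMatrix n) (w : Word n) (I I' J J' : Subset n) → Coxeter._≐_ M (Coxeter.DoubleCoset M I w J) (Coxeter.DoubleCoset M I' w J') → Coxeter._≐_ M (Coxeter.DoubleCoset M I w J) (Coxeter.DoubleCoset M (I ∪ I') w (J ∪ J'))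
lemma4p1 n M w I I' J J' C≐C' x =
  doubleCoset-mono (p⊆p∪q I') (p⊆p∪q J') ,
  doubleCoset-minimal C doubleCoset-respects left right doubleCoset-self
  where
  open Coxeter M
  open CoxeterProperties M

  C : Word n → Set
  C = DoubleCoset I w J

  left : LeftClosed (I ∪ I') C
  left = leftClosed-∪ C doubleCoset-leftClosed (leftClosed-≐ C C≐C' doubleCoset-leftClosed)

  right : RightClosed (J ∪ J') C
  right = rightClosed-∪ C doubleCoset-rightClosed (rightClosed-≐ C C≐C' doubleCoset-rightClosed)
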